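{- Let $\langle K,R\rangle$ be a Kripke frame. The axiom scheme $[\varphi\rightarrow(\psi\rightarrow\theta)]\rightarrow[(\varphi\&\psi)\rightarrow\theta]$ is satisfied in $\langle K,R\rangle$ (every instance, for all formulas $\varphi,\psi,\theta$, holds at every node of every Kripke model on this frame) if and only if for every $k\in K$ and every $x\in R^2[k]$ we have $xRx$.
   Context: Formulas are built from a countably infinite set of atoms and the constant $\bot$ (falsity) using the binary connectives $\&$ and $\rightarrow$. A Kripke frame is a pair $\langle K,R\rangle$ with $R\subseteq K\times K$ an arbitrary binary relation; a Kripke model on it is $\langle K,R,\vDash\rangle$ with $\vDash\subseteq K\times\mathsf{Atoms}$ arbitrary, extended to formulas by: $k\nvDash\bot$; $k\vDash\varphi\&\psi$ iff $k\vDash\varphi$ and $k\vDash\psi$; $k\vDash\varphi\rightarrow\psi$ iff for every $k'$ with $kRk'$, if $k'\vDash\varphi$ then $k'\vDash\psi$. For $k\in K$, $R^2[k]=\{x\mid \exists y\,(kRy \text{ and } yRx)\}$. -}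

module Defs where

open import Data.Nat using (ℕ)
open import Data.Product using (_×_; Σ-syntax)
open import Data.Empty using (⊥)

data Formula : Set where
  atom : ℕ → Formula
  falsum : Formula
  _&_ : Formula → Formula → Formula
  _⇒_ : Formula → Formula → Formula

infixr 6 _&_
infixr 5 _⇒_

record Frame : Set₁ where
  field
    K : Set
    R : K → K → Set

-- A Kripke model on a frame: an arbitrary forcing relation on atoms.
Valuation : Frame → Set₁
Valuation F = Frame.K F → ℕ → Set

forces : (F : Frame) → Valuation F → Frame.K F → Formula → Set
forces F V k (atom p) = V k p
forces F V k falsum = ⊥
forces F V k (φ & ψ) = forces F V k φ × forces F V k ψ
forces F V k (φ ⇒ ψ) = ∀ k' → Frame.R F k k' → forces F V k' φ → forces F V k' ψ

schemeInstance : Formula → Formula → Formula → Formula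
schemeInstance φ ψ θ = (φ ⇒ (ψ ⇒ θ)) ⇒ ((φ & ψ) ⇒ θ)

SchemeValid : Frame → Set₁
SchemeValid F = ∀ (V : Valuation F) (φ ψ θ : Formula) (k : Frame.K F) →
  forces F V k (schemeInstance φ ψ θ)

InR2 : (F : Frame) → Frame.K F → Frame.K F → Set
InR2 F k x = Σ[ y ∈ Frame.K F ] (Frame.R F k y × Frame.R F y x)

-- If a ⊨ φ → (ψ → θ) and b ⊨ φ & ψ for a successor b of a successor a of k,
-- then bRb, so the antecedent can be applied twice at b.  Conversely, given
-- kRy and yRx, let p hold only at x and q exactly at the R-successors of x:
-- then p → (p → q) holds at y, so the instance at k forces q at x, i.e. xRx.
module Submission where

open import Defs
open import Function.Bundles using (_⇔_; mk⇔)
open import Data.Nat using (zero; suc)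
open import Data.Product using (_,_)
open import Relation.Binary.PropositionalEquality using (_≡_; refl)

module _ (F : Frame) where
  open Frame F

  R²-reflexive⇒SchemeValid : (∀ k x → InR2 F k x → R x x) → SchemeValid F
  R²-reflexive⇒SchemeValid r²-refl V φ ψ θ k a kRa φ⇒ψ⇒θ b aRb (b⊨φ , b⊨ψ) =
    φ⇒ψ⇒θ b aRb b⊨φ b (r²-refl k b (a , kRa , aRb)) b⊨ψ

  pointAndSuccessors : K → Valuation F
  pointAndSuccessors x w zero    = w ≡ x
  pointAndSuccessors x w (suc _) = R x w

  pointAndSuccessors-curried : ∀ x y →
    forces F (pointAndSuccessors x) y (atom 0 ⇒ atom 0 ⇒ atom 1)
  pointAndSuccessors-curried x y .x _ refl w xRw refl = xRw

  SchemeValid⇒R²-reflexive : SchemeValid F → ∀ k x → InR2 F k x → R x x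
  SchemeValid⇒R²-reflexive valid k x (y , kRy , yRx) =
    valid (pointAndSuccessors x) (atom 0) (atom 0) (atom 1) k
      y kRy (pointAndSuccessors-curried x y) x yRx (refl , refl)

theorem4 : (F : Frame) →
    SchemeValid F ⇔ (∀ (k x : Frame.K F) → InR2 F k x → Frame.R F x x)
theorem4 F = mk⇔ (SchemeValid⇒R²-reflexive F) (R²-reflexive⇒SchemeValid F)
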